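{- Let $P,Q$ be posets with least elements and let $f : P \to Q$ and $g : Q \to P$ be monotone functions. If $\mu.(f \circ g) = (f \circ g)^{n}(\bot)$ for some $n\ge 0$, then $\mu.(g \circ f) = (g \circ f)^{n+1}(\bot)$. Therefore $\mathrm{cl}(g \circ f) \leq 1 + \mathrm{cl}(f \circ g)$.
   Context: For a monotone $h$ on a poset with least element $\bot$, $\mu.h$ denotes its least (pre)fixed point. $h$ converges in $n$ steps if $h^{n+1}(\bot)=h^n(\bot)$ (equivalently $\mu.h = h^n(\bot)$); the least such $n$ is the closure ordinal $\mathrm{cl}(h)$. -}

module Defs where

open import Level using (Level)
open import Data.Nat using (ℕ; zero; suc) renaming (_≤_ to _≤ℕ_)
open import Data.Product using (_×_)
open import Relation.Binary.Bundles using (Poset)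

iter : ∀ {a} {A : Set a} → (A → A) → ℕ → A → A
iter h zero    x = x
iter h (suc n) x = h (iter h n x)

module _ {c ℓ₁ ℓ₂ : Level} (P : Poset c ℓ₁ ℓ₂) where
  open Poset P

  IsLeast : Carrier → Set _
  IsLeast b = ∀ x → b ≤ x

  IsLeastFixedPoint : (Carrier → Carrier) → Carrier → Set _
  IsLeastFixedPoint h m = (h m ≈ m) × (∀ y → h y ≈ y → m ≤ y)

  ConvergesIn : (Carrier → Carrier) → Carrier → ℕ → Set _
  ConvergesIn h b n = IsLeastFixedPoint h (iter h n b)

  IsClosureOrdinal : (Carrier → Carrier) → Carrier → ℕ → Set _
  IsClosureOrdinal h b n = ConvergesIn h b n × (∀ m → ConvergesIn h b m → n ≤ℕ m)

IsMonotone : ∀ {c₁ ℓ₁ ℓ₁′ c₂ ℓ₂ ℓ₂′} (P : Poset c₁ ℓ₁ ℓ₁′) (Q : Poset c₂ ℓ₂ ℓ₂′)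
  → (Poset.Carrier P → Poset.Carrier Q) → Set _
IsMonotone P Q f = ∀ {x y} → Poset._≤_ P x y → Poset._≤_ Q (f x) (f y)

-- Rolling rule: if a is the least fixed point of f ∘ g then g a is the least
-- fixed point of g ∘ f, because f maps fixed points of g ∘ f to fixed points of
-- f ∘ g. Moreover (g ∘ f)ⁿ⁺¹(⊥) = g ((f ∘ g)ⁿ(f ⊥)), and since ⊥ ≤ f ⊥ ≤ μ.(f ∘ g),
-- monotonicity squeezes (f ∘ g)ⁿ(f ⊥) between (f ∘ g)ⁿ(⊥) = μ.(f ∘ g) and
-- (f ∘ g)ⁿ(μ.(f ∘ g)) = μ.(f ∘ g).
module Submission where

open import Defs
open import Level using (Level)
open import Data.Nat using (ℕ; zero; suc; _≤_)
open import Data.Product using (_×_; _,_)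
open import Function using (_∘_)
open import Relation.Binary.Bundles using (Poset)
open import Relation.Binary.PropositionalEquality using (_≡_; refl; sym; cong; subst)

iter-rotate : ∀ {a b} {A : Set a} {B : Set b} (f : A → B) (g : B → A) n x →
              iter (g ∘ f) (suc n) x ≡ g (iter (f ∘ g) n (f x))
iter-rotate f g zero    x = refl
iter-rotate f g (suc n) x = cong (g ∘ f) (iter-rotate f g n x)

monotone⇒cong : ∀ {c₁ ℓ₁ ℓ₁′ c₂ ℓ₂ ℓ₂′} (P : Poset c₁ ℓ₁ ℓ₁′) (Q : Poset c₂ ℓ₂ ℓ₂′) {f} →
                IsMonotone P Q f → ∀ {x y} → Poset._≈_ P x y → Poset._≈_ Q (f x) (f y)
monotone⇒cong P Q mono x≈y =
  Poset.antisym Q (mono (Poset.reflexive P x≈y)) (mono (Poset.reflexive P (Poset.Eq.sym P x≈y)))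

module _ {c₁ ℓ₁ ℓ₁′ c₂ ℓ₂ ℓ₂′ : Level} (P : Poset c₁ ℓ₁ ℓ₁′) (Q : Poset c₂ ℓ₂ ℓ₂′) where
  private
    module P = Poset P

  roll-leastFixedPoint : ∀ {f g a} → IsMonotone P Q f → IsMonotone Q P g →
                         IsLeastFixedPoint Q (f ∘ g) a → IsLeastFixedPoint P (g ∘ f) (g a)
  roll-leastFixedPoint {f} {g} {a} monoF monoG (fixed , least) = monotone⇒cong Q P monoG fixed , below
    where
    below : ∀ y → g (f y) P.≈ y → g a P.≤ y
    below y gfy≈y = P.trans (monoG (least (f y) (monotone⇒cong P Q monoF gfy≈y))) (P.reflexive gfy≈y)

module _ {c ℓ₁ ℓ₂ : Level} (P : Poset c ℓ₁ ℓ₂) where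
  open Poset P renaming (_≤_ to _⊑_)

  iter-monotone : ∀ {h} → IsMonotone P P h → ∀ n → IsMonotone P P (iter h n)
  iter-monotone mono zero    x≤y = x≤y
  iter-monotone mono (suc n) x≤y = mono (iter-monotone mono n x≤y)

  iter-fixedPoint : ∀ {h} → IsMonotone P P h → ∀ n {a} → h a ≈ a → iter h n a ≈ a
  iter-fixedPoint mono zero    fixed = Eq.refl
  iter-fixedPoint mono (suc n) fixed = Eq.trans (monotone⇒cong P P mono (iter-fixedPoint mono n fixed)) fixed

  iter-squeeze : ∀ {h} → IsMonotone P P h → ∀ n {b x} → h (iter h n b) ≈ iter h n b →
                 b ⊑ x → x ⊑ iter h n b → iter h n x ≈ iter h n b
  iter-squeeze mono n fixed b≤x x≤a =
    antisym (trans (iter-monotone mono n x≤a) (reflexive (iter-fixedPoint mono n fixed)))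
            (iter-monotone mono n b≤x)

  leastFixedPoint-resp-≈ : ∀ {h a b} → IsMonotone P P h → a ≈ b →
                           IsLeastFixedPoint P h a → IsLeastFixedPoint P h b
  leastFixedPoint-resp-≈ mono a≈b (fixed , least) =
    Eq.trans (monotone⇒cong P P mono (Eq.sym a≈b)) (Eq.trans fixed a≈b) ,
    λ y hy≈y → trans (reflexive (Eq.sym a≈b)) (least y hy≈y)

proposition6p1 : ∀ {c₁ ℓ₁ ℓ₁′ c₂ ℓ₂ ℓ₂′ : Level}
    (P : Poset c₁ ℓ₁ ℓ₁′) (Q : Poset c₂ ℓ₂ ℓ₂′)
    (⊥P : Poset.Carrier P) (⊥Q : Poset.Carrier Q)
    → IsLeast P ⊥P → IsLeast Q ⊥Q
    → (f : Poset.Carrier P → Poset.Carrier Q) (g : Poset.Carrier Q → Poset.Carrier P)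
    → IsMonotone P Q f → IsMonotone Q P g
    → (∀ (n : ℕ) → ConvergesIn Q (f ∘ g) ⊥Q n → ConvergesIn P (g ∘ f) ⊥P (suc n))
    × (∀ (n m : ℕ) → IsClosureOrdinal Q (f ∘ g) ⊥Q n → IsClosureOrdinal P (g ∘ f) ⊥P m
    → m ≤ suc n)
proposition6p1 P Q ⊥P ⊥Q leastP leastQ f g monoF monoG = converges , closureOrdinal-bound
  where
  module Q = Poset Q

  converges : ∀ n → ConvergesIn Q (f ∘ g) ⊥Q n → ConvergesIn P (g ∘ f) ⊥P (suc n)
  converges n lfp@(fixed , _) =
    subst (IsLeastFixedPoint P (g ∘ f)) (sym (iter-rotate f g n ⊥P)) shifted
    where
    f⊥≤μ : f ⊥P Q.≤ iter (f ∘ g) n ⊥Q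
    f⊥≤μ = Q.trans (monoF (leastP _)) (Q.reflexive fixed)
    squeezed : iter (f ∘ g) n (f ⊥P) Q.≈ iter (f ∘ g) n ⊥Q
    squeezed = iter-squeeze Q (monoF ∘ monoG) n fixed (leastQ (f ⊥P)) f⊥≤μ
    shifted : IsLeastFixedPoint P (g ∘ f) (g (iter (f ∘ g) n (f ⊥P)))
    shifted = leastFixedPoint-resp-≈ P (monoG ∘ monoF) (monotone⇒cong Q P monoG (Q.Eq.sym squeezed))
                (roll-leastFixedPoint P Q monoF monoG lfp)

  closureOrdinal-bound : ∀ n m → IsClosureOrdinal Q (f ∘ g) ⊥Q n →
                         IsClosureOrdinal P (g ∘ f) ⊥P m → m ≤ suc n
  closureOrdinal-bound n m (convergesQ , _) (_ , minimal) = minimal (suc n) (converges n convergesQ)
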